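{- Let $G \simeq C_{n_1}\oplus\cdots\oplus C_{n_r}$ with $1<n_1\mid\cdots\mid n_r$ be a finite Abelian group, $n=\exp(G)$, $m=\tau(n)$, $\mathcal{D}_n=\{d_1,\dots,d_m\}$. Then $$\mathsf{k}(G)\leq \max_{x\in\mathbb{P}_G}\sum_{i=1}^m\frac{x_{d_i}}{d_i},$$ where $\mathbb{P}_G=\{x\in\mathbb{N}^m : f_d(x)\geq0 \text{ and } g_d(x)\geq0 \text{ for all } d\in\mathcal{D}_n\}$.
   Context: Notation: $C_k$ is the cyclic group of order $k$; $\mathcal{D}_k$ the set of positive divisors of $k$; $\tau(k)=|\mathcal{D}_k|$. A sequence of $G$ is a finite sequence of elements (repetitions allowed); it is zero-sumfree if no nonempty subfamily sums to $0$. $\mathsf{k}(S)=\sum_{g\in S}1/\mathrm{ord}(g)$, $\mathsf{k}(G)=\max\{\mathsf{k}(S): S\text{ zero-sumfree}\}$. For a finite Abelian group $K$, $\mathsf{D}(K)$ is the least $t\geq1$ such that every sequence of $K$ of length $\geq t$ has a nonempty zero-sum subsequence; $\eta(K)$ is the least $t\geq1$ such that every sequence of length $\geq t$ has a nonempty zero-sum subsequence of length $\leq\exp(K)$. For $d\in\mathcal{D}_n$, $d'\in\mathcal{D}_d$, $i\in\{1,\dots,r\}$: $A_i=\gcd(d',n_i)$, $B_i=\mathrm{lcm}(d,n_i)/\mathrm{lcm}(d',n_i)$, $\upsilon_i(d',d)=A_i/\gcd(A_i,B_i)$, $G_{\upsilon(d',d)}=C_{\upsilon_1(d',d)}\oplus\cdots\oplus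 C_{\upsilon_r(d',d)}$. For $x=(x_{d_1},\dots,x_{d_m})\in\mathbb{N}^m$ and $d\in\mathcal{D}_n$: $f_d(x)=\min_{d'\in\mathcal{D}_d\setminus\{1\}}\eta(G_{\upsilon(d',d)})-1-x_d$ and $g_d(x)=\mathsf{D}(G_{\upsilon(d,d)})-1-\sum_{d'\in\mathcal{D}_d}x_{d'}$. -}

module Defs where

open import Data.Nat using (ℕ; zero; suc; _+_; _*_; _∸_; _<_)
open import Data.Nat as N using ()
open import Data.Nat.DivMod using (_/_)
open import Data.Nat.Divisibility using (_∣_; _∣?_)
open import Data.Nat.GCD using (gcd)
open import Data.Nat.LCM using (lcm)
open import Data.Bool using (Bool; true; false; if_then_else_)
open import Data.Fin using (Fin)
open import Data.Vec using (Vec; []; _∷_; lookup; zipWith; replicate; foldr; map)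
open import Data.List using (List; length; filter; applyUpTo)
open import Data.Nat.ListAction using () renaming (sum to sumℕ)
import Data.List as L
open import Data.List.Relation.Unary.All using (All)
open import Data.List.Relation.Binary.Sublist.Propositional using (_⊆_)
open import Data.Product using (_×_; Σ; ∃; _,_)
open import Data.Empty using (⊥)
open import Data.Unit using (⊤)
open import Data.Integer using (+_)
open import Data.Rational using (ℚ; 0ℚ; _≤_)
open import Relation.Binary.PropositionalEquality using (_≢_)
import Data.Rational as Q
open import Relation.Nullary using (¬_; does)
open import Relation.Nullary.Decidable using (⌊_⌋)
import Data.Bool

-- Groups C_{k_1} ⊕ ⋯ ⊕ C_{k_r}, given by the vector of moduli ks.
-- An element is a vector g with 0 ≤ g_i < k_i (componentwise residues).

InGroup : ∀ {r} → Vec ℕ r → Vec ℕ r → Set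
InGroup {r} ks g = (i : Fin r) → lookup g i < lookup ks i

Positive : ∀ {r} → Vec ℕ r → Set
Positive {r} ks = (i : Fin r) → 0 < lookup ks i

-- sum of a sequence of elements (componentwise, as natural numbers;
-- only its residues mod k_i matter)
vsum : ∀ {r} → List (Vec ℕ r) → Vec ℕ r
vsum {r} = L.foldr (zipWith _+_) (replicate r 0)

IsZero : ∀ {r} → Vec ℕ r → Vec ℕ r → Set
IsZero {r} ks g = (i : Fin r) → lookup ks i ∣ lookup g i

IsSeq : ∀ {r} → Vec ℕ r → List (Vec ℕ r) → Set
IsSeq ks S = All (InGroup ks) S

HasZeroSumSub : ∀ {r} → Vec ℕ r → List (Vec ℕ r) → Set
HasZeroSumSub ks S = Σ _ λ T → T ⊆ S × 0 < length T × IsZero ks (vsum T)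

ZeroSumFree : ∀ {r} → Vec ℕ r → List (Vec ℕ r) → Set
ZeroSumFree ks S = ¬ HasZeroSumSub ks S

expo : ∀ {r} → Vec ℕ r → ℕ
expo = foldr _ lcm 1

HasShortZeroSumSub : ∀ {r} → Vec ℕ r → List (Vec ℕ r) → Set
HasShortZeroSumSub ks S =
  Σ _ λ T → T ⊆ S × 0 < length T × length T N.≤ expo ks × IsZero ks (vsum T)

IsLeastThreshold : ∀ {r} → Vec ℕ r → (List (Vec ℕ r) → Set) → ℕ → Set
IsLeastThreshold ks P t =
  1 N.≤ t
  × ((S : List _) → IsSeq ks S → t N.≤ length S → P S)
  × ((t' : ℕ) → 1 N.≤ t' → ((S : List _) → IsSeq ks S → t' N.≤ length S → P S) → t N.≤ t')

IsDavenport : ∀ {r} → Vec ℕ r → ℕ → Set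
IsDavenport ks = IsLeastThreshold ks (HasZeroSumSub ks)

IsEta : ∀ {r} → Vec ℕ r → ℕ → Set
IsEta ks = IsLeastThreshold ks (HasShortZeroSumSub ks)

-- Order of an element: least m ≥ 1 with m·g = 0, found by bounded search
-- (the order divides |K| = ∏ k_i, which is used as the search bound).

search : (ℕ → Bool) → ℕ → ℕ → ℕ
search P zero    c = c
search P (suc f) c = if P c then c else search P f (suc c)

prod : ∀ {r} → Vec ℕ r → ℕ
prod = foldr _ _*_ 1

kills : ∀ {r} → Vec ℕ r → Vec ℕ r → ℕ → Bool
kills ks g m = foldr _ Data.Bool._∧_ true (zipWith (λ k a → ⌊ k ∣? m * a ⌋) ks g)

ord : ∀ {r} → Vec ℕ r → Vec ℕ r → ℕ
ord ks g = search (kills ks g) (prod ks) 1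

-- a / b as a rational (b = 0 never occurs below; mapped to 0)
frac : ℕ → ℕ → ℚ
frac a zero    = 0ℚ
frac a (suc b) = (+ a) Q./ suc b

sumℚ : List ℚ → ℚ
sumℚ = L.foldr Q._+_ 0ℚ

kk : ∀ {r} → Vec ℕ r → List (Vec ℕ r) → ℚ
kk ks S = sumℚ (L.map (λ g → frac 1 (ord ks g)) S)

divisors : ℕ → List ℕ
divisors n = filter (λ d → d ∣? n) (applyUpTo suc n)

-- natural division with a / 0 = 0 (only used with positive divisors)
_div_ : ℕ → ℕ → ℕ
a div zero    = 0
a div (suc b) = a / suc b

υ : ∀ {r} → Vec ℕ r → ℕ → ℕ → Vec ℕ r
υ ns d' d = map (λ nᵢ →
  let A = gcd d' nᵢ
      B = lcm d nᵢ div lcm d' nᵢ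
  in A div gcd A B) ns

DivChain : ∀ {r} → Vec ℕ r → Set
DivChain [] = ⊤
DivChain (a ∷ []) = ⊤
DivChain (a ∷ b ∷ ns) = a ∣ b × DivChain (b ∷ ns)

ValidType : ∀ {r} → Vec ℕ r → Set
ValidType [] = ⊥
ValidType (a ∷ ns) = 1 < a × DivChain (a ∷ ns)

-- The polytope 𝕡_G.  x : ℕ → ℕ, only the coordinates x_d (d ∣ n) matter.
-- Dv, ηv are the functions K ↦ D(K), K ↦ η(K).

-- f_d(x) ≥ 0  ⇔  for every d' ∣ d with d' ≠ 1:  x_d + 1 ≤ η(G_{υ(d',d)})
-- (min over the empty set, d = 1, is +∞: no constraint)
fNonneg : ∀ {r} → (∀ {s} → Vec ℕ s → ℕ) → Vec ℕ r → (ℕ → ℕ) → ℕ → Set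
fNonneg ηv ns x d =
  (d' : ℕ) → 0 < d' → d' ∣ d → d' ≢ 1 → x d + 1 N.≤ ηv (υ ns d' d)

gNonneg : ∀ {r} → (∀ {s} → Vec ℕ s → ℕ) → Vec ℕ r → (ℕ → ℕ) → ℕ → Set
gNonneg Dv ns x d = sumℕ (L.map x (divisors d)) + 1 N.≤ Dv (υ ns d d)

InP : ∀ {r} → (Dv ηv : ∀ {s} → Vec ℕ s → ℕ) → Vec ℕ r → (ℕ → ℕ) → Set
InP Dv ηv ns x =
  (d : ℕ) → 0 < d → d ∣ expo ns → fNonneg ηv ns x d × gNonneg Dv ns x d

objective : ∀ {r} → Vec ℕ r → (ℕ → ℕ) → ℚ
objective ns x = sumℚ (L.map (λ d → frac (x d) d) (divisors (expo ns)))

-- Induction on the length of the zero-sum free sequence S, with x_d the number of terms of S of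
-- order d, so that k(S) = Σ_d x_d / d.  For d' ∣ d, multiplying by d/d' and then dividing the
-- i-th coordinate by nᵢ/υᵢ maps the elements killed by d to G_υ(d',d), and if the images of T sum
-- to 0 then (d/d')·σ(T) = 0 in G.  If g_d(x) < 0, the terms of order dividing d are at least
-- D(G_υ(d,d)) many, so their images contain a zero sum, which pulls back to a zero sum of S.
-- If f_d(x) < 0 because of some d' > 1, the terms of order d contain T with |T| ≤ exp(G_υ(d',d)) ≤ d'
-- whose images sum to 0; replacing T by σ(T), of order at most d/d', keeps S zero-sum free,
-- shortens it (|T| ≥ 2) and does not decrease k, as |T|/d ≤ d'/d ≤ 1/ord σ(T).  When no f_d
-- fails, x lies in 𝕡_G.
module Submission where

module Arithmetic where
  open import Data.Nat using (ℕ; zero; suc; _+_; _*_; _<_; z≤n; s≤s; z<s; >-nonZero)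
  open import Data.Nat.Properties
  open import Data.Nat.DivMod using (_%_; _/_; m≡m%n+[m/n]*n; m%n<n; m/n*n≡m; n/n≡1)
  open import Data.Nat.Divisibility
  open import Data.Nat.GCD
  open import Data.Nat.LCM
  open import Data.Nat.ListAction using (sum)
  open import Data.Nat.Tactic.RingSolver using (solve-∀)
  open import Data.List using (List; []; _∷_; map)
  import Data.List.Properties as List
  open import Data.List.Relation.Unary.All using (All; []; _∷_)
  open import Data.Product using (Σ; _,_)
  open import Data.Sum using (inj₁)
  open import Relation.Binary.PropositionalEquality
  open import Relation.Nullary using (contradiction)
  open import Defs using (_div_)

  private
    variable
      a b d d' m n : ℕ

  _rem_ : ℕ → ℕ → ℕ
  a rem zero  = a
  a rem suc u = a % suc u

  rem< : ∀ {a u} → 0 < u → a rem u < u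
  rem< {a} {suc u} _ = m%n<n a (suc u)

  rem+multiple : ∀ a u → Σ ℕ λ q → a ≡ a rem u + q * u
  rem+multiple a zero    = 0 , sym (+-identityʳ a)
  rem+multiple a (suc u) = a / suc u , m≡m%n+[m/n]*n a (suc u)

  sum-rem+multiple : ∀ u xs → Σ ℕ λ q → sum xs ≡ sum (map (_rem u) xs) + q * u
  sum-rem+multiple u []       = 0 , refl
  sum-rem+multiple u (x ∷ xs) with rem+multiple x u | sum-rem+multiple u xs
  ... | q , x≡ | q' , xs≡ = q + q' , (begin
    x + sum xs                                          ≡⟨ cong₂ _+_ x≡ xs≡ ⟩
    (x rem u + q * u) + (sum (map (_rem u) xs) + q' * u) ≡⟨ regroup (x rem u) q _ q' u ⟩
    (x rem u + sum (map (_rem u) xs)) + (q + q') * u     ∎)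
    where
    open ≡-Reasoning
    regroup : ∀ a b c d w → (a + b * w) + (c + d * w) ≡ (a + c) + (b + d) * w
    regroup = solve-∀

  ∣-sum-rem⇒∣-sum : ∀ u xs → u ∣ sum (map (_rem u) xs) → u ∣ sum xs
  ∣-sum-rem⇒∣-sum u xs u∣ with sum-rem+multiple u xs
  ... | q , eq = subst (u ∣_) (sym eq) (∣m∣n⇒∣m+n u∣ (n∣m*n q))

  div*≡ : 0 < b → b ∣ a → a div b * b ≡ a
  div*≡ {suc b} _ b∣a = m/n*n≡m b∣a

  *≡⇒pos : m * n ≡ a → 0 < a → 0 < m
  *≡⇒pos {zero} refl ()
  *≡⇒pos {suc m} _ _ = s≤s z≤n

  0<d/d' : 0 < d → 0 < d' → d' ∣ d → 0 < d div d'
  0<d/d' 0<d 0<d' d'∣d = *≡⇒pos (div*≡ 0<d' d'∣d) 0<d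

  ≢1⇒1< : 0 < n → n ≢ 1 → 1 < n
  ≢1⇒1< {suc zero}    _ n≢1 = contradiction refl n≢1
  ≢1⇒1< {suc (suc n)} _ _   = s≤s z<s

  d/d≡1 : 0 < d → d div d ≡ 1
  d/d≡1 {suc d} _ = n/n≡1 (suc d)

  d/d'<d : 0 < d → 1 < d' → d' ∣ d → d div d' < d
  d/d'<d {d} {d'} 0<d 1<d' d'∣d = subst (d div d' <_) (div*≡ (<-trans (s≤s z≤n) 1<d') d'∣d)
    (m<m*n (d div d') d' {{>-nonZero (0<d/d' 0<d (<-trans (s≤s z≤n) 1<d') d'∣d)}} 1<d')

  0<gcd : 0 < m → 0 < gcd m n
  0<gcd {m} {n} 0<m = n≢0⇒n>0 (gcd[m,n]≢0 m n (inj₁ (m<n⇒n≢0 0<m)))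

  0<lcm : 0 < m → 0 < n → 0 < lcm m n
  0<lcm {m} {n} 0<m 0<n = *≡⇒pos (trans (*-comm (lcm m n) (gcd m n)) (gcd*lcm m n)) (*-mono-< 0<m 0<n)

  υᵢ : ℕ → ℕ → ℕ → ℕ
  υᵢ d' d n = gcd d' n div gcd (gcd d' n) (lcm d n div lcm d' n)

  module _ (d' d n : ℕ) (0<d' : 0 < d') where
    private
      A = gcd d' n
      G = gcd A (lcm d n div lcm d' n)

    υᵢ*gcd≡gcd : υᵢ d' d n * G ≡ A
    υᵢ*gcd≡gcd = div*≡ (0<gcd (0<gcd 0<d')) (gcd[m,n]∣m A _)

    0<υᵢ : 0 < υᵢ d' d n
    0<υᵢ = *≡⇒pos υᵢ*gcd≡gcd (0<gcd 0<d')

    υᵢ∣gcd : υᵢ d' d n ∣ A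
    υᵢ∣gcd = divides G (trans (sym υᵢ*gcd≡gcd) (*-comm (υᵢ d' d n) G))

    υᵢ∣d' : υᵢ d' d n ∣ d'
    υᵢ∣d' = ∣-trans υᵢ∣gcd (gcd[m,n]∣m d' n)

    n/υᵢ*υᵢ≡n : n div υᵢ d' d n * υᵢ d' d n ≡ n
    n/υᵢ*υᵢ≡n = div*≡ 0<υᵢ (∣-trans υᵢ∣gcd (gcd[m,n]∣n d' n))

  lcm-ratio : 0 < d' → 0 < n → d' ∣ d →
    (lcm d n div lcm d' n) * gcd d n ≡ (d div d') * gcd d' n
  lcm-ratio {d'} {n} {d} 0<d' 0<n d'∣d = *-cancelʳ-≡ _ _ (d' * n) {{>-nonZero (*-mono-< 0<d' 0<n)}} (begin
    (B * gcd d n) * (d' * n)        ≡⟨ cong ((B * gcd d n) *_) (sym (gcd*lcm d' n)) ⟩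
    (B * gcd d n) * (A * lcm d' n)  ≡⟨ shuffle B (gcd d n) A (lcm d' n) ⟩
    A * (gcd d n * (B * lcm d' n))  ≡⟨ cong (λ l → A * (gcd d n * l)) (div*≡ (0<lcm 0<d' 0<n) lcm'∣lcm) ⟩
    A * (gcd d n * lcm d n)         ≡⟨ cong (A *_) (gcd*lcm d n) ⟩
    A * (d * n)                     ≡⟨ cong (λ x → A * (x * n)) (sym (div*≡ 0<d' d'∣d)) ⟩
    A * ((e * d') * n)              ≡⟨ shuffle′ A e d' n ⟩
    (e * A) * (d' * n)              ∎)
    where
    open ≡-Reasoning
    A = gcd d' n
    B = lcm d n div lcm d' n
    e = d div d'
    lcm'∣lcm : lcm d' n ∣ lcm d n
    lcm'∣lcm = lcm-least (∣-trans d'∣d (m∣lcm[m,n] d n)) (n∣lcm[m,n] d n)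
    shuffle : ∀ x y z w → (x * y) * (z * w) ≡ z * (y * (x * w))
    shuffle = solve-∀
    shuffle′ : ∀ x y z w → x * ((y * z) * w) ≡ (y * x) * (z * w)
    shuffle′ = solve-∀

  n/υᵢ∣d/d'*a : 0 < n → 0 < d' → d' ∣ d → n ∣ d * a → n div υᵢ d' d n ∣ (d div d') * a
  n/υᵢ∣d/d'*a {n} {d'} {d} {a} 0<n 0<d' d'∣d n∣da =
    *-cancelˡ-∣ A {{>-nonZero (0<gcd 0<d')}} (subst (_∣ A * (e * a)) nG≡Am nG∣Aea)
    where
    A = gcd d' n
    B = lcm d n div lcm d' n
    G = gcd A B
    u = υᵢ d' d n
    e = d div d'
    nG≡Am : n * G ≡ A * (n div u)
    nG≡Am = begin
      n * G                    ≡⟨ cong (_* G) (sym (n/υᵢ*υᵢ≡n d' d n 0<d')) ⟩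
      (n div u * u) * G        ≡⟨ *-assoc (n div u) u G ⟩
      n div u * (u * G)        ≡⟨ cong (n div u *_) (υᵢ*gcd≡gcd d' d n 0<d') ⟩
      n div u * A              ≡⟨ *-comm (n div u) A ⟩
      A * (n div u)            ∎
      where open ≡-Reasoning
    n∣gcd*a : n ∣ gcd d n * a
    n∣gcd*a = subst (n ∣_) (trans (sym (c*gcd[m,n]≡gcd[cm,cn] a d n)) (*-comm a (gcd d n)))
                (gcd-greatest (subst (n ∣_) (*-comm d a) n∣da) (∣n⇒∣m*n a ∣-refl))
    nG∣Aea : n * G ∣ A * (e * a)
    nG∣Aea = subst (n * G ∣_) (begin
      (gcd d n * a) * B  ≡⟨ swap (gcd d n) a B ⟩
      (B * gcd d n) * a  ≡⟨ cong (_* a) (lcm-ratio 0<d' 0<n d'∣d) ⟩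
      (e * A) * a        ≡⟨ swap′ e A a ⟩
      A * (e * a)        ∎) (*-pres-∣ n∣gcd*a (gcd[m,n]∣n A B))
      where
      open ≡-Reasoning
      swap : ∀ x y z → (x * y) * z ≡ (z * x) * y
      swap = solve-∀
      swap′ : ∀ x y z → (x * y) * z ≡ y * (x * z)
      swap′ = solve-∀

  *-sum-div : ∀ e m {as} → 0 < m → All (λ a → m ∣ e * a) as →
    m * sum (map (λ a → (e * a) div m) as) ≡ e * sum as
  *-sum-div e m 0<m []                        = trans (*-zeroʳ m) (sym (*-zeroʳ e))
  *-sum-div e m {a ∷ as} 0<m (m∣ea ∷ m∣eas) = begin
    m * ((e * a) div m + sum (map (λ a → (e * a) div m) as))   ≡⟨ *-distribˡ-+ m _ _ ⟩
    m * ((e * a) div m) + m * sum (map (λ a → (e * a) div m) as)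
      ≡⟨ cong₂ _+_ (trans (*-comm m _) (div*≡ 0<m m∣ea)) (*-sum-div e m 0<m m∣eas) ⟩
    e * a + e * sum as                                     ≡⟨ *-distribˡ-+ e a _ ⟨
    e * (a + sum as)                                       ∎
    where open ≡-Reasoning

  ∣-sum-quotients⇒∣ : ∀ e m u as → 0 < m → All (λ a → m ∣ e * a) as →
    u ∣ sum (map (λ a → ((e * a) div m) rem u) as) → m * u ∣ e * sum as
  ∣-sum-quotients⇒∣ e m u as 0<m m∣eas u∣ =
    subst (m * u ∣_) (*-sum-div e m 0<m m∣eas)
      (*-monoʳ-∣ m (∣-sum-rem⇒∣-sum u (map (λ a → (e * a) div m) as)
        (subst (λ xs → u ∣ sum xs) (List.map-∘ {g = _rem u} {f = λ a → (e * a) div m} as) u∣)))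

module Divisors where
  open import Data.Nat using (ℕ; zero; suc; _<_; z≤n; s≤s)
  open import Data.Nat.Properties using (suc-injective; <⇒≢)
  open import Data.Nat.Divisibility using (_∣_; _∣?_; ∣⇒≤; ∣-trans; 1∣_)
  open import Data.Nat.LCM using (m∣lcm[m,n]; n∣lcm[m,n]; lcm-least)
  open import Data.Fin using (zero; suc)
  open import Data.Vec using (Vec; []; _∷_; lookup)
  open import Data.List using (applyUpTo)
  open import Data.List.Membership.Propositional using (_∈_)
  open import Data.List.Membership.Propositional.Properties
    using (∈-filter⁺; ∈-filter⁻; ∈-applyUpTo⁺; ∈-applyUpTo⁻)
  open import Data.List.Relation.Unary.Unique.Propositional using (Unique)
  import Data.List.Relation.Unary.Unique.Propositional.Properties as Unique
  open import Data.Product using (_×_; _,_)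
  open import Function using (_∘_)
  open import Relation.Binary.PropositionalEquality using (refl)
  open import Defs using (divisors; expo; Positive)
  open Arithmetic using (0<lcm)

  ∈-divisors⁺ : ∀ {d n} → 0 < d → 0 < n → d ∣ n → d ∈ divisors n
  ∈-divisors⁺ {suc d} {suc n} _ _ d∣n =
    ∈-filter⁺ (_∣? suc n) (∈-applyUpTo⁺ suc (∣⇒≤ d∣n)) d∣n

  ∈-divisors⁻ : ∀ {d} n → d ∈ divisors n → 0 < d × d ∣ n
  ∈-divisors⁻ n d∈ with ∈-filter⁻ (_∣? n) {xs = applyUpTo suc n} d∈
  ... | d∈upTo , d∣n with ∈-applyUpTo⁻ suc d∈upTo
  ...   | _ , _ , refl = s≤s z≤n , d∣n

  divisors-unique : ∀ n → Unique (divisors n)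
  divisors-unique n = Unique.filter⁺ (_∣? n)
    (Unique.applyUpTo⁺₁ suc n (λ i<j _ → <⇒≢ i<j ∘ suc-injective))

  lookup∣expo : ∀ {r} (ks : Vec ℕ r) i → lookup ks i ∣ expo ks
  lookup∣expo (k ∷ ks) zero    = m∣lcm[m,n] k (expo ks)
  lookup∣expo (k ∷ ks) (suc i) = ∣-trans (lookup∣expo ks i) (n∣lcm[m,n] k (expo ks))

  expo-least : ∀ {r} (ks : Vec ℕ r) {c} → (∀ i → lookup ks i ∣ c) → expo ks ∣ c
  expo-least []       {c} _  = 1∣ c
  expo-least (k ∷ ks)     ks∣ = lcm-least (ks∣ zero) (expo-least ks (λ i → ks∣ (suc i)))

  0<expo : ∀ {r} (ks : Vec ℕ r) → Positive ks → 0 < expo ks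
  0<expo []       _   = s≤s z≤n
  0<expo (k ∷ ks) pos = 0<lcm (pos zero) (0<expo ks (λ i → pos (suc i)))

module Order where
  open import Data.Nat using (ℕ; zero; suc; _+_; _*_; _≤_; z≤n; s≤s)
  open import Data.Nat.Properties
  open import Data.Nat.DivMod using (_%_; _/_; m≡m%n+[m/n]*n; m%n<n)
  open import Data.Nat.Divisibility
  open import Data.Bool using (Bool; true; false)
  open import Data.Fin using (Fin; zero; suc)
  open import Data.Vec using (Vec; []; _∷_; lookup)
  open import Data.Sum using (inj₁; inj₂)
  open import Relation.Binary.PropositionalEquality
  open import Relation.Nullary using (yes; no; contradiction)
  open import Defs using (search; kills; ord; prod; Positive)

  Kills : ∀ {r} → Vec ℕ r → Vec ℕ r → ℕ → Set
  Kills {r} ks g m = (i : Fin r) → lookup ks i ∣ m * lookup g i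

  kills⇒Kills : ∀ {r} (ks g : Vec ℕ r) m → kills ks g m ≡ true → Kills ks g m
  kills⇒Kills (k ∷ ks) (a ∷ g) m eq i with k ∣? m * a
  kills⇒Kills (k ∷ ks) (a ∷ g) m eq zero    | yes k∣ = k∣
  kills⇒Kills (k ∷ ks) (a ∷ g) m eq (suc i) | yes _  = kills⇒Kills ks g m eq i

  Kills⇒kills : ∀ {r} (ks g : Vec ℕ r) m → Kills ks g m → kills ks g m ≡ true
  Kills⇒kills []       []      _ _ = refl
  Kills⇒kills (k ∷ ks) (a ∷ g) m ks∣ with k ∣? m * a
  ... | yes _ = Kills⇒kills ks g m (λ i → ks∣ (suc i))
  ... | no k∤ = contradiction (ks∣ zero) k∤

  Kills-* : ∀ {r} (ks g : Vec ℕ r) {m} k → Kills ks g m → Kills ks g (k * m)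
  Kills-* ks g {m} k ks∣ i = subst (lookup ks i ∣_) (sym (*-assoc k m (lookup g i))) (∣n⇒∣m*n k (ks∣ i))

  search-≥ : ∀ (P : ℕ → Bool) f c → c ≤ search P f c
  search-≥ P zero    c = ≤-refl
  search-≥ P (suc f) c with P c
  ... | true  = ≤-refl
  ... | false = ≤-trans (n≤1+n c) (search-≥ P f (suc c))

  search-≤ : ∀ (P : ℕ → Bool) f c {m} → c ≤ m → P m ≡ true → search P f c ≤ m
  search-≤ P zero    c c≤m _ = c≤m
  search-≤ P (suc f) c c≤m Pm with P c in Pc
  ... | true  = c≤m
  ... | false with m≤n⇒m<n∨m≡n c≤m
  ...   | inj₁ c<m  = search-≤ P f (suc c) c<m Pm
  ...   | inj₂ refl = contradiction (trans (sym Pc) Pm) λ ()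

  search-sound : ∀ (P : ℕ → Bool) f c {m} → c ≤ m → m ≤ c + f → P m ≡ true → P (search P f c) ≡ true
  search-sound P zero    c {m} c≤m m≤c Pm =
    subst (λ x → P x ≡ true) (≤-antisym (subst (m ≤_) (+-identityʳ c) m≤c) c≤m) Pm
  search-sound P (suc f) c {m} c≤m m≤c Pm with P c in Pc
  ... | true  = Pc
  ... | false with m≤n⇒m<n∨m≡n c≤m
  ...   | inj₁ c<m  = search-sound P f (suc c) c<m (subst (m ≤_) (+-suc c f) m≤c) Pm
  ...   | inj₂ refl = contradiction (trans (sym Pc) Pm) λ ()

  1≤ord : ∀ {r} (ks g : Vec ℕ r) → 1 ≤ ord ks g
  1≤ord ks g = search-≥ (kills ks g) (prod ks) 1

  ord-minimal : ∀ {r} (ks g : Vec ℕ r) {m} → 1 ≤ m → Kills ks g m → ord ks g ≤ m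
  ord-minimal ks g {m} 1≤m ks∣ = search-≤ (kills ks g) (prod ks) 1 1≤m (Kills⇒kills ks g m ks∣)

  lookup∣prod : ∀ {r} (ks : Vec ℕ r) i → lookup ks i ∣ prod ks
  lookup∣prod (k ∷ ks) zero    = m∣m*n (prod ks)
  lookup∣prod (k ∷ ks) (suc i) = ∣n⇒∣m*n k (lookup∣prod ks i)

  1≤prod : ∀ {r} (ks : Vec ℕ r) → Positive ks → 1 ≤ prod ks
  1≤prod []       _   = s≤s z≤n
  1≤prod (k ∷ ks) pos = *-mono-≤ (pos zero) (1≤prod ks (λ i → pos (suc i)))

  -- prod ks always kills g, so the bounded search in ord succeeds
  ord-kills : ∀ {r} (ks g : Vec ℕ r) → Positive ks → Kills ks g (ord ks g)
  ord-kills ks g pos = kills⇒Kills ks g (ord ks g)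
    (search-sound (kills ks g) (prod ks) 1 (1≤prod ks pos) (n≤1+n (prod ks))
      (Kills⇒kills ks g (prod ks) (λ i → ∣m⇒∣m*n (lookup g i) (lookup∣prod ks i))))

  ord∣ : ∀ {r} (ks g : Vec ℕ r) → Positive ks → ∀ {m} → Kills ks g m → ord ks g ∣ m
  ord∣ ks g pos {m} ks∣ with ord ks g | 1≤ord ks g | ord-kills ks g pos | ord-minimal ks g
  ... | suc o | _ | ks∣o | minimal = m%n≡0⇒n∣m m (suc o) m%o≡0
    where
    ks∣m%o : Kills ks g (m % suc o)
    ks∣m%o i = ∣m+n∣m⇒∣n (subst (lookup ks i ∣_) split (ks∣ i)) (Kills-* ks g (m / suc o) ks∣o i)
      where
      split : m * lookup g i ≡ m / suc o * suc o * lookup g i + m % suc o * lookup g i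
      split = trans (cong (_* lookup g i) (trans (m≡m%n+[m/n]*n m (suc o)) (+-comm (m % suc o) _)))
                    (*-distribʳ-+ (lookup g i) (m / suc o * suc o) (m % suc o))
    m%o≡0 : m % suc o ≡ 0
    m%o≡0 with m % suc o in eq | m%n<n m (suc o)
    ... | zero  | _        = refl
    ... | suc k | sk<suc-o = contradiction (minimal (s≤s z≤n) (subst (Kills ks g) eq ks∣m%o)) (<⇒≱ sk<suc-o)

  ∣⇒Kills : ∀ {r} (ks g : Vec ℕ r) → Positive ks → ∀ {m} → ord ks g ∣ m → Kills ks g m
  ∣⇒Kills ks g pos (divides k refl) = Kills-* ks g k (ord-kills ks g pos)

module Sublists where
  open import Data.List using (List; []; _∷_; _++_; map)
  open import Data.List.Relation.Binary.Sublist.Propositional using (_⊆_; []; _∷_; _∷ʳ_)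
  open import Data.List.Relation.Binary.Permutation.Propositional
    using (_↭_; ↭-refl; ↭-prep; ↭-trans; ↭-sym)
  open import Data.List.Relation.Binary.Permutation.Propositional.Properties using (shift)
  open import Data.Product using (Σ; _×_; _,_)
  open import Relation.Binary.PropositionalEquality using (_≡_; refl)

  ⊆-map⁻¹ : {A B : Set} (f : A → B) {S : List A} {U : List B} →
    U ⊆ map f S → Σ (List A) λ T → T ⊆ S × map f T ≡ U
  ⊆-map⁻¹ f {S = []}    []       = [] , [] , refl
  ⊆-map⁻¹ f {S = x ∷ S} (_ ∷ʳ p) with ⊆-map⁻¹ f p
  ... | T , T⊆S , refl = T , x ∷ʳ T⊆S , refl
  ⊆-map⁻¹ f {S = x ∷ S} (refl ∷ p) with ⊆-map⁻¹ f p
  ... | T , T⊆S , refl = x ∷ T , refl ∷ T⊆S , refl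

  module _ {A : Set} where
    complement : {T S : List A} → T ⊆ S → List A
    complement []       = []
    complement (x ∷ʳ p) = x ∷ complement p
    complement (_ ∷ p)  = complement p

    complement-⊆ : {T S : List A} (p : T ⊆ S) → complement p ⊆ S
    complement-⊆ []       = []
    complement-⊆ (x ∷ʳ p) = refl ∷ complement-⊆ p
    complement-⊆ (x ∷ p)  = _ ∷ʳ complement-⊆ p

    ↭-++-complement : {T S : List A} (p : T ⊆ S) → S ↭ T ++ complement p
    ↭-++-complement []                   = ↭-refl
    ↭-++-complement {T = T} (x ∷ʳ p)     =
      ↭-trans (↭-prep x (↭-++-complement p)) (↭-sym (shift x T (complement p)))
    ↭-++-complement (refl ∷ p)           = ↭-prep _ (↭-++-complement p)

    ⊆-complement-++ : {T S U : List A} (p : T ⊆ S) → U ⊆ complement p → Σ (List A) λ W → W ⊆ S × W ↭ U ++ T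
    ⊆-complement-++ []       []       = [] , [] , ↭-refl
    ⊆-complement-++ (x ∷ʳ p) (_ ∷ʳ q) with ⊆-complement-++ p q
    ... | W , W⊆S , W↭ = W , x ∷ʳ W⊆S , W↭
    ⊆-complement-++ (x ∷ʳ p) (refl ∷ q) with ⊆-complement-++ p q
    ... | W , W⊆S , W↭ = x ∷ W , refl ∷ W⊆S , ↭-prep x W↭
    ⊆-complement-++ {T = x ∷ T} {U = U} (refl ∷ p) q with ⊆-complement-++ p q
    ... | W , W⊆S , W↭ = x ∷ W , refl ∷ W⊆S , ↭-trans (↭-prep x W↭) (↭-sym (shift x U T))

module Fractions where
  open import Data.Nat as ℕ using (ℕ; zero; suc)
  import Data.Nat.Properties as ℕ
  import Data.Integer as ℤ
  import Data.Integer.Properties as ℤ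
  open import Data.Integer.Tactic.RingSolver using (solve-∀)
  open import Data.List using ([]; _∷_; _++_)
  open import Data.List.Relation.Binary.Permutation.Propositional using (_↭_; ↭⇒↭ₛ)
  open import Data.List.Relation.Binary.Permutation.Setoid.Properties using (foldr-commMonoid)
  open import Data.Rational using (0ℚ; _≤_; _+_; toℚᵘ)
  open import Data.Rational.Properties
  open import Data.Rational.Unnormalised as ℚᵘ using (mkℚᵘ; *≡*; *≤*)
  import Data.Rational.Unnormalised.Properties as ℚᵘ
  open import Algebra.Bundles using (CommutativeMonoid)
  open import Relation.Binary.PropositionalEquality
  open import Defs using (frac; sumℚ)

  private
    toℚᵘ-frac : ∀ a b → toℚᵘ (frac a (suc b)) ℚᵘ.≃ mkℚᵘ (ℤ.+ a) b
    toℚᵘ-frac a b = toℚᵘ-fromℚᵘ (mkℚᵘ (ℤ.+ a) b)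

  frac-+ : ∀ a b e → frac (a ℕ.+ b) e ≡ frac a e + frac b e
  frac-+ a b zero    = sym (+-identityˡ 0ℚ)
  frac-+ a b (suc e) = toℚᵘ-injective (begin
    toℚᵘ (frac (a ℕ.+ b) (suc e))              ≈⟨ toℚᵘ-frac (a ℕ.+ b) e ⟩
    mkℚᵘ (ℤ.+ (a ℕ.+ b)) e                        ≈⟨ *≡* numerators ⟩
    mkℚᵘ (ℤ.+ a) e ℚᵘ.+ mkℚᵘ (ℤ.+ b) e              ≈⟨ ℚᵘ.+-cong (toℚᵘ-frac a e) (toℚᵘ-frac b e) ⟨
    toℚᵘ (frac a (suc e)) ℚᵘ.+ toℚᵘ (frac b (suc e)) ≈⟨ toℚᵘ-homo-+ (frac a (suc e)) (frac b (suc e)) ⟨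
    toℚᵘ (frac a (suc e) + frac b (suc e))      ∎)
    where
    open ℚᵘ.≃-Reasoning
    distrib : ∀ (x y c : ℤ.ℤ) → (x ℤ.+ y) ℤ.* (c ℤ.* c) ≡ (x ℤ.* c ℤ.+ y ℤ.* c) ℤ.* c
    distrib = solve-∀
    numerators = trans (cong₂ ℤ._*_ (ℤ.pos-+ a b) (ℤ.pos-* (suc e) (suc e))) (distrib (ℤ.+ a) (ℤ.+ b) (ℤ.+ suc e))

  frac-cross-≤ : ∀ {a b c d} → 0 ℕ.< c → 0 ℕ.< d → a ℕ.* d ℕ.≤ b ℕ.* c → frac a c ≤ frac b d
  frac-cross-≤ {a} {b} {suc c} {suc d} _ _ ad≤bc = toℚᵘ-cancel-≤
    (ℚᵘ.≤-respʳ-≃ (ℚᵘ.≃-sym (toℚᵘ-frac b d)) (ℚᵘ.≤-respˡ-≃ (ℚᵘ.≃-sym (toℚᵘ-frac a c))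
      (*≤* (subst₂ ℤ._≤_ (ℤ.pos-* a (suc d)) (ℤ.pos-* b (suc c)) (ℤ.+≤+ ad≤bc)))))

  frac-monoˡ-≤ : ∀ {a b} e → a ℕ.≤ b → frac a e ≤ frac b e
  frac-monoˡ-≤         zero    _   = ≤-refl
  frac-monoˡ-≤ {a} {b} (suc e) a≤b = frac-cross-≤ {a} {b} {suc e} {suc e} ℕ.z<s ℕ.z<s (ℕ.*-monoˡ-≤ (suc e) a≤b)

  frac-zero : ∀ e → frac 0 e ≡ 0ℚ
  frac-zero zero    = refl
  frac-zero (suc e) = 0/n≡0 (suc e)

  0≤frac : ∀ a e → 0ℚ ≤ frac a e
  0≤frac a e = subst (_≤ frac a e) (frac-zero e) (frac-monoˡ-≤ e ℕ.z≤n)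

  sumℚ-++ : ∀ xs ys → sumℚ (xs ++ ys) ≡ sumℚ xs + sumℚ ys
  sumℚ-++ []       ys = sym (+-identityˡ (sumℚ ys))
  sumℚ-++ (x ∷ xs) ys = trans (cong (x +_) (sumℚ-++ xs ys)) (sym (+-assoc x (sumℚ xs) (sumℚ ys)))

  sumℚ-↭ : ∀ {xs ys} → xs ↭ ys → sumℚ xs ≡ sumℚ ys
  sumℚ-↭ xs↭ys = foldr-commMonoid +-0.setoid +-0.isCommutativeMonoid (↭⇒↭ₛ xs↭ys)
    where module +-0 = CommutativeMonoid +-0-commutativeMonoid

module Multiplicities where
  open import Data.Nat using (ℕ; suc; _+_; _≤_; _≟_; z≤n)
  open import Data.Nat.Properties using (≤-reflexive; +-mono-≤; m≤n+m)
  open import Data.Nat.ListAction using (sum)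
  open import Data.Nat.Tactic.RingSolver using (solve-∀)
  open import Data.List using (List; []; _∷_; _++_; [_]; map; filter; length)
  open import Data.List.Properties using (filter-none; filter-accept; filter-reject; filter-++; length-++)
  open import Data.List.Membership.Propositional using (_∈_)
  open import Data.List.Relation.Unary.All using (All; []; _∷_)
  open import Data.List.Relation.Unary.All.Properties using (¬Any⇒All¬)
  open import Data.List.Relation.Unary.Any using (here; there)
  open import Data.List.Relation.Unary.Unique.Propositional using (Unique)
  open import Data.List.Relation.Unary.AllPairs using ([]; _∷_)
  import Data.Rational as ℚ
  open import Data.Rational using (0ℚ)
  import Data.Rational.Properties as ℚ
  open import Relation.Binary.PropositionalEquality hiding ([_])
  open import Relation.Nullary using (yes; no)
  open import Relation.Unary using (Pred; Decidable)
  open import Function using (_∘_)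
  open import Level using (0ℓ)
  open import Defs using (frac; sumℚ)
  open Fractions

  occurrences : ℕ → List ℕ → ℕ
  occurrences x Ds = length (filter (x ≟_) Ds)

  occurrences-++ : ∀ x Ds Es → occurrences x (Ds ++ Es) ≡ occurrences x Ds + occurrences x Es
  occurrences-++ x Ds Es = trans (cong length (filter-++ (x ≟_) Ds Es)) (length-++ (filter (x ≟_) Ds))

  occurrences-∉ : ∀ x {Ds} → All (x ≢_) Ds → occurrences x Ds ≡ 0
  occurrences-∉ x x∉Ds = cong length (filter-none (x ≟_) x∉Ds)

  occurrences-unique : ∀ x {Ds} → Unique Ds → occurrences x Ds ≤ 1
  occurrences-unique x {[]}     []            = z≤n
  occurrences-unique x {e ∷ Ds} (e∉Ds ∷ uniq) with x ≟ e
  ... | yes refl = ≤-reflexive (trans (cong length (filter-accept (x ≟_) refl)) (cong suc (occurrences-∉ x e∉Ds)))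
  ... | no x≢e   = subst (_≤ 1) (sym (cong length (filter-reject (x ≟_) x≢e))) (occurrences-unique x uniq)

  sum-map-zero : ∀ {A : Set} (xs : List A) → sum (map (λ _ → 0) xs) ≡ 0
  sum-map-zero []       = refl
  sum-map-zero (_ ∷ xs) = sum-map-zero xs

  module _ {A : Set} (o : A → ℕ) where

    multiplicity : List A → ℕ → ℕ
    multiplicity S e = length (filter (λ a → o a ≟ e) S)

    multiplicity-∷ : ∀ a S e → multiplicity (a ∷ S) e ≡ occurrences (o a) [ e ] + multiplicity S e
    multiplicity-∷ a S e with o a ≟ e
    ... | yes oa≡e = trans (cong length (filter-accept (λ a → o a ≟ e) oa≡e))
                       (cong (λ l → length l + multiplicity S e) (sym (filter-accept (o a ≟_) oa≡e)))
    ... | no oa≢e  = trans (cong length (filter-reject (λ a → o a ≟ e) oa≢e))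
                       (cong (λ l → length l + multiplicity S e) (sym (filter-reject (o a ≟_) oa≢e)))

    sum-multiplicity-∷ : ∀ a S Ds →
      sum (map (multiplicity (a ∷ S)) Ds) ≡ occurrences (o a) Ds + sum (map (multiplicity S) Ds)
    sum-multiplicity-∷ a S []       = refl
    sum-multiplicity-∷ a S (e ∷ Ds) = begin
      multiplicity (a ∷ S) e + sum (map (multiplicity (a ∷ S)) Ds)
        ≡⟨ cong₂ _+_ (multiplicity-∷ a S e) (sum-multiplicity-∷ a S Ds) ⟩
      (occurrences (o a) [ e ] + multiplicity S e) + (occurrences (o a) Ds + sum (map (multiplicity S) Ds))
        ≡⟨ exchange (occurrences (o a) [ e ]) _ _ _ ⟩
      (occurrences (o a) [ e ] + occurrences (o a) Ds) + (multiplicity S e + sum (map (multiplicity S) Ds))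
        ≡⟨ cong (_+ _) (occurrences-++ (o a) [ e ] Ds) ⟨
      occurrences (o a) (e ∷ Ds) + sum (map (multiplicity S) (e ∷ Ds))  ∎
      where
      open ≡-Reasoning
      exchange : ∀ w x y z → (w + x) + (y + z) ≡ (w + y) + (x + z)
      exchange = solve-∀

    sum-multiplicity≤ : ∀ {P : Pred ℕ 0ℓ} (P? : Decidable P) {Ds} → Unique Ds → (∀ {e} → e ∈ Ds → P e) →
      ∀ S → sum (map (multiplicity S) Ds) ≤ length (filter (P? ∘ o) S)
    sum-multiplicity≤ P? {Ds} uniq Ds⊆P []      = ≤-reflexive (sum-map-zero Ds)
    sum-multiplicity≤ P? {Ds} uniq Ds⊆P (a ∷ S) with P? (o a)
    ... | yes _   = subst (_≤ _) (sym (sum-multiplicity-∷ a S Ds))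
                      (+-mono-≤ (occurrences-unique (o a) uniq) (sum-multiplicity≤ P? uniq Ds⊆P S))
    ... | no ¬Poa = subst (_≤ _) (sym (trans (sum-multiplicity-∷ a S Ds) (cong (_+ _) oa∉Ds)))
                      (sum-multiplicity≤ P? uniq Ds⊆P S)
      where
      oa∉Ds : occurrences (o a) Ds ≡ 0
      oa∉Ds = occurrences-∉ (o a) (¬Any⇒All¬ Ds (¬Poa ∘ Ds⊆P))

    multiplicity-∷-mono : ∀ a S e → multiplicity S e ≤ multiplicity (a ∷ S) e
    multiplicity-∷-mono a S e = subst (multiplicity S e ≤_) (sym (multiplicity-∷ a S e)) (m≤n+m _ _)

    multiplicity-∷-self : ∀ a S → multiplicity (a ∷ S) (o a) ≡ suc (multiplicity S (o a))
    multiplicity-∷-self a S = cong length (filter-accept (λ a′ → o a′ ≟ o a) refl)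

    weight : List A → List ℕ → ℚ.ℚ
    weight S Ds = sumℚ (map (λ e → frac (multiplicity S e) e) Ds)

    weight-∷-mono : ∀ a S Ds → weight S Ds ℚ.≤ weight (a ∷ S) Ds
    weight-∷-mono a S []       = ℚ.≤-refl
    weight-∷-mono a S (e ∷ Ds) = ℚ.+-mono-≤ (frac-monoˡ-≤ e (multiplicity-∷-mono a S e)) (weight-∷-mono a S Ds)

    weight-∷ : ∀ a S {Ds} → o a ∈ Ds → frac 1 (o a) ℚ.+ weight S Ds ℚ.≤ weight (a ∷ S) Ds
    weight-∷ a S {_ ∷ Ds} (here refl) = begin
      frac 1 (o a) ℚ.+ (frac (multiplicity S (o a)) (o a) ℚ.+ weight S Ds)
        ≡⟨ ℚ.+-assoc (frac 1 (o a)) _ _ ⟨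
      (frac 1 (o a) ℚ.+ frac (multiplicity S (o a)) (o a)) ℚ.+ weight S Ds
        ≡⟨ cong (ℚ._+ weight S Ds) (frac-+ 1 _ (o a)) ⟨
      frac (suc (multiplicity S (o a))) (o a) ℚ.+ weight S Ds
        ≡⟨ cong (λ m → frac m (o a) ℚ.+ weight S Ds) (multiplicity-∷-self a S) ⟨
      frac (multiplicity (a ∷ S) (o a)) (o a) ℚ.+ weight S Ds
        ≤⟨ ℚ.+-monoʳ-≤ (frac (multiplicity (a ∷ S) (o a)) (o a)) (weight-∷-mono a S Ds) ⟩
      weight (a ∷ S) (o a ∷ Ds)  ∎
      where open ℚ.≤-Reasoning
    weight-∷ a S {e ∷ Ds} (there oa∈Ds) = begin
      frac 1 (o a) ℚ.+ (frac (multiplicity S e) e ℚ.+ weight S Ds)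
        ≡⟨ exchange (frac 1 (o a)) (frac (multiplicity S e) e) (weight S Ds) ⟩
      frac (multiplicity S e) e ℚ.+ (frac 1 (o a) ℚ.+ weight S Ds)
        ≤⟨ ℚ.+-mono-≤ (frac-monoˡ-≤ e (multiplicity-∷-mono a S e)) (weight-∷ a S oa∈Ds) ⟩
      weight (a ∷ S) (e ∷ Ds)  ∎
      where
      open ℚ.≤-Reasoning
      exchange : ∀ x y z → x ℚ.+ (y ℚ.+ z) ≡ y ℚ.+ (x ℚ.+ z)
      exchange x y z = trans (sym (ℚ.+-assoc x y z)) (trans (cong (ℚ._+ z) (ℚ.+-comm x y)) (ℚ.+-assoc y x z))

    0≤weight[] : ∀ Ds → 0ℚ ℚ.≤ weight [] Ds
    0≤weight[] []       = ℚ.≤-refl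
    0≤weight[] (e ∷ Ds) = ℚ.+-mono-≤ (0≤frac 0 e) (0≤weight[] Ds)

    sum-inverse≤weight : ∀ {Ds} S → All (λ a → o a ∈ Ds) S →
      sumℚ (map (λ a → frac 1 (o a)) S) ℚ.≤ weight S Ds
    sum-inverse≤weight {Ds} []      []              = 0≤weight[] Ds
    sum-inverse≤weight      (a ∷ S) (oa∈Ds ∷ S∈Ds) =
      ℚ.≤-trans (ℚ.+-monoʳ-≤ (frac 1 (o a)) (sum-inverse≤weight S S∈Ds)) (weight-∷ a S oa∈Ds)

module Reduction where
  open import Data.Nat using (ℕ; suc; _+_; _*_; _<_; _≤_; z≤n; s≤s; z<s; _≟_; _<?_; _≤?_; >-nonZero)
  open import Data.Nat.Induction using (<-wellFounded)
  open import Data.Nat.Properties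
  open import Data.Nat.Divisibility
  open import Data.Nat.ListAction using (sum)
  open import Data.Nat.ListAction.Properties using (sum-++; sum-↭)
  open import Data.Fin using (Fin)
  open import Data.Vec using (Vec; []; _∷_; lookup; zipWith)
  open import Data.Vec.Properties using (lookup-map; lookup-zipWith; lookup-replicate)
  open import Data.List using (List; []; _∷_; _++_; map; length; filter)
  open import Data.List.Properties using (map-++; length-map; length-++)
  open import Data.List.Relation.Binary.Sublist.Propositional using (_⊆_; _∷_; _∷ʳ_; ⊆-trans)
  open import Data.List.Relation.Binary.Sublist.Propositional.Properties using (All-resp-⊆; filter-⊆)
  open import Data.List.Relation.Unary.All using (All; []; _∷_)
  import Data.List.Relation.Unary.All as All
  import Data.List.Relation.Unary.All.Properties as All
  open import Data.List.Relation.Binary.Permutation.Propositional using (_↭_)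
  import Data.List.Relation.Binary.Permutation.Propositional.Properties as ↭
  open import Data.Product using (Σ; _×_; _,_; proj₁; proj₂)
  open import Relation.Binary.PropositionalEquality
  open import Relation.Nullary using (¬_; Dec; yes; no; contradiction)
  open import Relation.Nullary.Decidable using (_×-dec_)
  open import Data.List.Relation.Unary.Any using (Any; any?)
  open import Data.List.Membership.Propositional using (_∈_; find; lose)
  import Induction.WellFounded as WF
  open import Induction.WellFounded using (WfRec)
  import Relation.Binary.Construct.On as On
  open import Level using (0ℓ)
  open import Function using (_∘_; _on_)
  import Data.Rational as ℚ
  import Data.Rational.Properties as ℚ
  open import Defs
  open Arithmetic
  open Divisors
  open Order
  open Sublists
  open Fractions
  open Multiplicities

  module _ {r : ℕ} where

    sumAt : Fin r → List (Vec ℕ r) → ℕ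
    sumAt i T = sum (map (λ g → lookup g i) T)

    lookup-vsum : ∀ T i → lookup (vsum T) i ≡ sumAt i T
    lookup-vsum []      i = lookup-replicate i 0
    lookup-vsum (g ∷ T) i = trans (lookup-zipWith _+_ i g (vsum T)) (cong (lookup g i +_) (lookup-vsum T i))

    sumAt-++ : ∀ i U T → sumAt i (U ++ T) ≡ sumAt i U + sumAt i T
    sumAt-++ i U T = trans (cong sum (map-++ (λ g → lookup g i) U T)) (sum-++ (map _ U) _)

    sumAt-↭ : ∀ i {U T} → U ↭ T → sumAt i U ≡ sumAt i T
    sumAt-↭ i U↭T = sum-↭ (↭.map⁺ (λ g → lookup g i) U↭T)

  lookup-υ : ∀ {r} (ns : Vec ℕ r) d' d i → lookup (υ ns d' d) i ≡ υᵢ d' d (lookup ns i)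
  lookup-υ ns d' d i = lookup-map i (υᵢ d' d) ns

  Positive-υ : ∀ {r} (ns : Vec ℕ r) {d'} d → 0 < d' → Positive (υ ns d' d)
  Positive-υ ns {d'} d 0<d' i = subst (0 <_) (sym (lookup-υ ns d' d i)) (0<υᵢ d' d _ 0<d')

  expo-υ∣ : ∀ {r} (ns : Vec ℕ r) {d'} d → 0 < d' → expo (υ ns d' d) ∣ d'
  expo-υ∣ ns {d'} d 0<d' = expo-least (υ ns d' d) λ i →
    subst (_∣ d') (sym (lookup-υ ns d' d i)) (υᵢ∣d' d' d _ 0<d')

  zero∈P : (Dv ηv : ∀ {s} → Vec ℕ s → ℕ) →
    (∀ {s} (ks : Vec ℕ s) → Positive ks → IsDavenport ks (Dv ks)) →
    (∀ {s} (ks : Vec ℕ s) → Positive ks → IsEta ks (ηv ks)) →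
    ∀ {r} (ns : Vec ℕ r) → InP Dv ηv ns (λ _ → 0)
  zero∈P Dv ηv isD isη ns d 0<d _ =
    (λ d' 0<d' _ _ → proj₁ (isη (υ ns d' d) (Positive-υ ns d 0<d'))) ,
    subst (λ m → m + 1 ≤ Dv (υ ns d d)) (sym (sum-map-zero (divisors d))) (proj₁ (isD (υ ns d d) (Positive-υ ns d 0<d)))

  -- ψ d' d maps the elements of G killed by d into G_υ(d',d), coordinatewise
  -- a ↦ (d/d')·a / (nᵢ/υᵢ) mod υᵢ; the division is exact by n/υᵢ∣d/d'*a.
  ψᵢ : ℕ → ℕ → ℕ → ℕ → ℕ
  ψᵢ d' d n a = (((d div d') * a) div (n div υᵢ d' d n)) rem υᵢ d' d n

  module _ {r : ℕ} (ns : Vec ℕ r) (pos : Positive ns) where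

    ψ : ℕ → ℕ → Vec ℕ r → Vec ℕ r
    ψ d' d = zipWith (ψᵢ d' d) ns

    ψ-InGroup : ∀ {d'} d → 0 < d' → ∀ g → InGroup (υ ns d' d) (ψ d' d g)
    ψ-InGroup {d'} d 0<d' g i = subst₂ _<_ (sym (lookup-zipWith (ψᵢ d' d) i ns g)) (sym (lookup-υ ns d' d i))
      (rem< (0<υᵢ d' d _ 0<d'))

    sumAt-ψ : ∀ d' d i T → sumAt i (map (ψ d' d) T) ≡ sum (map (ψᵢ d' d (lookup ns i)) (map (λ g → lookup g i) T))
    sumAt-ψ d' d i []      = refl
    sumAt-ψ d' d i (g ∷ T) = cong₂ _+_ (lookup-zipWith (ψᵢ d' d) i ns g) (sumAt-ψ d' d i T)

    ψ-zero-sum⇒ : ∀ {d' d} → 0 < d' → d' ∣ d → ∀ T → All (λ g → Kills ns g d) T →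
      IsZero (υ ns d' d) (vsum (map (ψ d' d) T)) → ∀ i → lookup ns i ∣ (d div d') * sumAt i T
    ψ-zero-sum⇒ {d'} {d} 0<d' d'∣d T T-killed ψT≡0 i =
      subst (_∣ (d div d') * sumAt i T) (n/υᵢ*υᵢ≡n d' d n 0<d')
        (∣-sum-quotients⇒∣ (d div d') (n div υᵢ d' d n) (υᵢ d' d n) (map (λ g → lookup g i) T)
          (*≡⇒pos (n/υᵢ*υᵢ≡n d' d n 0<d') (pos i))
          (All.map⁺ (All.map (λ ks∣ → n/υᵢ∣d/d'*a (pos i) 0<d' d'∣d (ks∣ i)) T-killed))
          (subst₂ _∣_ (lookup-υ ns d' d i) (trans (lookup-vsum (map (ψ d' d) T) i) (sumAt-ψ d' d i T)) (ψT≡0 i)))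
      where n = lookup ns i

    reduce : Vec ℕ r → Vec ℕ r
    reduce = zipWith (λ n a → a rem n) ns

    lookup-reduce : ∀ v i → lookup (reduce v) i ≡ lookup v i rem lookup ns i
    lookup-reduce v i = lookup-zipWith (λ n a → a rem n) i ns v

    reduce-InGroup : ∀ v → InGroup ns (reduce v)
    reduce-InGroup v i = subst (_< lookup ns i) (sym (lookup-reduce v i)) (rem< (pos i))

    σ : List (Vec ℕ r) → Vec ℕ r
    σ T = reduce (vsum T)

    lookup-σ : ∀ T i → lookup (σ T) i ≡ sumAt i T rem lookup ns i
    lookup-σ T i = trans (lookup-reduce (vsum T) i) (cong (_rem lookup ns i) (lookup-vsum T i))

    ZeroSumFree-merge : ∀ {S T} → ZeroSumFree ns S → (T⊆S : T ⊆ S) → 0 < length T →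
      ZeroSumFree ns (σ T ∷ complement T⊆S)
    ZeroSumFree-merge zsf T⊆S _ (U , _ ∷ʳ U⊆ , 0<|U| , U≡0) =
      zsf (U , ⊆-trans U⊆ (complement-⊆ T⊆S) , 0<|U| , U≡0)
    ZeroSumFree-merge {T = T} zsf T⊆S 0<|T| (_ ∷ U , refl ∷ U⊆ , _ , σT∷U≡0)
      with ⊆-complement-++ T⊆S U⊆
    ... | W , W⊆S , W↭U++T = zsf (W , W⊆S , 0<|W| , W≡0)
      where
      0<|W| : 0 < length W
      0<|W| = subst (0 <_) (sym (trans (↭.↭-length W↭U++T) (length-++ U)))
                (<-≤-trans 0<|T| (m≤n+m (length T) (length U)))
      W≡0 : IsZero ns (vsum W)
      W≡0 i with rem+multiple (sumAt i T) (lookup ns i)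
      ... | q , T≡ = subst (lookup ns i ∣_) (sym (begin
        lookup (vsum W) i                                        ≡⟨ lookup-vsum W i ⟩
        sumAt i W                                                ≡⟨ sumAt-↭ i W↭U++T ⟩
        sumAt i (U ++ T)                                         ≡⟨ sumAt-++ i U T ⟩
        sumAt i U + sumAt i T                                    ≡⟨ cong (sumAt i U +_) T≡ ⟩
        sumAt i U + (sumAt i T rem lookup ns i + q * lookup ns i) ≡⟨ +-assoc (sumAt i U) _ _ ⟨
        (sumAt i U + sumAt i T rem lookup ns i) + q * lookup ns i ≡⟨ cong (_+ q * lookup ns i) (+-comm (sumAt i U) _) ⟩
        (sumAt i T rem lookup ns i + sumAt i U) + q * lookup ns i ∎))
        (∣m∣n⇒∣m+n (subst (lookup ns i ∣_) σT+U≡ (σT∷U≡0 i)) (n∣m*n q))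
        where
        open ≡-Reasoning
        σT+U≡ : lookup (vsum (σ T ∷ U)) i ≡ sumAt i T rem lookup ns i + sumAt i U
        σT+U≡ = trans (lookup-vsum (σ T ∷ U) i) (cong (_+ sumAt i U) (lookup-σ T i))

    Kills-σ : ∀ {e} T → (∀ i → lookup ns i ∣ e * sumAt i T) → Kills ns (σ T) e
    Kills-σ {e} T n∣eT i with rem+multiple (sumAt i T) (lookup ns i)
    ... | q , T≡ = ∣m+n∣m⇒∣n (subst (lookup ns i ∣_) eT≡ (n∣eT i)) (n∣m*n (e * q))
      where
      eT≡ : e * sumAt i T ≡ e * q * lookup ns i + e * lookup (σ T) i
      eT≡ = begin
        e * sumAt i T                                           ≡⟨ cong (e *_) T≡ ⟩
        e * (sumAt i T rem lookup ns i + q * lookup ns i)       ≡⟨ *-distribˡ-+ e _ _ ⟩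
        e * (sumAt i T rem lookup ns i) + e * (q * lookup ns i) ≡⟨ +-comm (e * (sumAt i T rem lookup ns i)) _ ⟩
        e * (q * lookup ns i) + e * (sumAt i T rem lookup ns i) ≡⟨ cong₂ _+_ (*-assoc e q _) (cong (e *_) (lookup-σ T i)) ⟨
        e * q * lookup ns i + e * lookup (σ T) i                ∎
        where open ≡-Reasoning

    -- A single element of order d is not killed by any 0 < e < d.
    2≤length : ∀ {d e} T → All (λ g → ord ns g ≡ d) T → 0 < length T → 0 < e → e < d →
      (∀ i → lookup ns i ∣ e * sumAt i T) → 2 ≤ length T
    2≤length (_ ∷ _ ∷ _) _ _ _ _ _ = s≤s (s≤s z≤n)
    2≤length {e = e} (g ∷ []) (refl ∷ []) _ 0<e e<ord n∣eg = contradiction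
      (ord-minimal ns g 0<e (λ i → subst (λ a → lookup ns i ∣ e * a) (+-identityʳ (lookup g i)) (n∣eg i)))
      (<⇒≱ e<ord)

    kk-constant-order : ∀ {d} T → All (λ g → ord ns g ≡ d) T → kk ns T ≡ frac (length T) d
    kk-constant-order {d} []      []            = sym (frac-zero d)
    kk-constant-order {d} (g ∷ T) (refl ∷ ordT) =
      trans (cong (frac 1 (ord ns g) ℚ.+_) (kk-constant-order T ordT)) (sym (frac-+ 1 (length T) (ord ns g)))

    length-split : ∀ {S T : List (Vec ℕ r)} (T⊆S : T ⊆ S) → length S ≡ length T + length (complement T⊆S)
    length-split {T = T} T⊆S = trans (↭.↭-length (↭-++-complement T⊆S)) (length-++ T)

    kk-split : ∀ {S T : List (Vec ℕ r)} (T⊆S : T ⊆ S) → kk ns S ≡ kk ns T ℚ.+ kk ns (complement T⊆S)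
    kk-split {S} {T} T⊆S = begin
      sumℚ (map inverse-ord S)                                   ≡⟨ sumℚ-↭ (↭.map⁺ inverse-ord (↭-++-complement T⊆S)) ⟩
      sumℚ (map inverse-ord (T ++ complement T⊆S))               ≡⟨ cong sumℚ (map-++ inverse-ord T _) ⟩
      sumℚ (map inverse-ord T ++ map inverse-ord (complement T⊆S)) ≡⟨ sumℚ-++ (map inverse-ord T) _ ⟩
      kk ns T ℚ.+ kk ns (complement T⊆S)                         ∎
      where
      open ≡-Reasoning
      inverse-ord : Vec ℕ r → ℚ.ℚ
      inverse-ord g = frac 1 (ord ns g)

    record Improvement (S S′ : List (Vec ℕ r)) : Set where
      field
        isSeq       : IsSeq ns S′
        zeroSumFree : ZeroSumFree ns S′
        shorter     : length S′ < length S
        kk-≤        : kk ns S ℚ.≤ kk ns S′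

    merge-improves : ∀ {S T d d'} → IsSeq ns S → ZeroSumFree ns S → 0 < d → 1 < d' → d' ∣ d →
      (T⊆S : T ⊆ S) → All (λ g → ord ns g ≡ d) T → 0 < length T → length T ≤ d' →
      (∀ i → lookup ns i ∣ (d div d') * sumAt i T) → Improvement S (σ T ∷ complement T⊆S)
    merge-improves {S} {T} {d} {d'} seq zsf 0<d 1<d' d'∣d T⊆S ordT 0<|T| |T|≤d' n∣eT = record
      { isSeq       = reduce-InGroup (vsum T) ∷ All-resp-⊆ (complement-⊆ T⊆S) seq
      ; zeroSumFree = ZeroSumFree-merge {S} {T} zsf T⊆S 0<|T|
      ; shorter     = subst (suc (length (complement T⊆S)) <_) (sym (length-split T⊆S))
          (+-monoˡ-≤ (length (complement T⊆S)) (2≤length {d} {e} T ordT 0<|T| 0<e (d/d'<d 0<d 1<d' d'∣d) n∣eT))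
      ; kk-≤        = subst (ℚ._≤ kk ns (σ T ∷ complement T⊆S)) (sym (kk-split T⊆S))
          (ℚ.+-monoˡ-≤ (kk ns (complement T⊆S)) kkT≤)
      }
      where
      e = d div d'
      0<e : 0 < e
      0<e = 0<d/d' 0<d (<-trans z<s 1<d') d'∣d
      kkT≤ : kk ns T ℚ.≤ frac 1 (ord ns (σ T))
      kkT≤ = subst (ℚ._≤ frac 1 (ord ns (σ T))) (sym (kk-constant-order T ordT))
        (frac-cross-≤ 0<d (1≤ord ns (σ T)) (begin
          length T * ord ns (σ T) ≤⟨ *-mono-≤ |T|≤d' (ord-minimal ns (σ T) 0<e (Kills-σ {e} T n∣eT)) ⟩
          d' * e                  ≡⟨ *-comm d' e ⟩
          e * d'                  ≡⟨ div*≡ (<-trans z<s 1<d') d'∣d ⟩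
          d                       ≡⟨ +-identityʳ d ⟨
          1 * d                   ∎))
        where open ≤-Reasoning

    orderCount : List (Vec ℕ r) → ℕ → ℕ
    orderCount = multiplicity (ord ns)

    ψ-zero-sum-lift : ∀ {d' d} → 0 < d' → d' ∣ d → ∀ L → All (λ g → Kills ns g d) L →
      ∀ {U} → U ⊆ map (ψ d' d) L → IsZero (υ ns d' d) (vsum U) →
      Σ (List (Vec ℕ r)) λ T → T ⊆ L × length T ≡ length U × (∀ i → lookup ns i ∣ (d div d') * sumAt i T)
    ψ-zero-sum-lift {d'} {d} 0<d' d'∣d L L-killed U⊆ U≡0 with ⊆-map⁻¹ (ψ d' d) U⊆
    ... | T , T⊆L , refl =
      T , T⊆L , sym (length-map (ψ d' d) T) , ψ-zero-sum⇒ 0<d' d'∣d T (All-resp-⊆ T⊆L L-killed) U≡0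

    module _ (Dv ηv : ∀ {s} → Vec ℕ s → ℕ)
             (isD : ∀ {s} (ks : Vec ℕ s) → Positive ks → IsDavenport ks (Dv ks))
             (isη : ∀ {s} (ks : Vec ℕ s) → Positive ks → IsEta ks (ηv ks)) where

      Davenport-bound : ∀ S → ZeroSumFree ns S → ∀ {d} → 0 < d → gNonneg Dv ns (orderCount S) d
      Davenport-bound S zsf {d} 0<d =
        ≤-trans (+-monoˡ-≤ 1 (sum-multiplicity≤ (ord ns) (_∣? d) (divisors-unique d) (proj₂ ∘ ∈-divisors⁻ d) S))
          (subst (_≤ Dv K) (+-comm 1 (length L)) (≰⇒> DvK≰|L|))
        where
        K = υ ns d d
        L = filter (λ g → ord ns g ∣? d) S
        L-killed : All (λ g → Kills ns g d) L
        L-killed = All.map (∣⇒Kills ns _ pos) (All.all-filter (λ g → ord ns g ∣? d) S)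
        no-zero-sum : ¬ HasZeroSumSub K (map (ψ d d) L)
        no-zero-sum (U , U⊆ , 0<|U| , U≡0) with ψ-zero-sum-lift 0<d ∣-refl L L-killed U⊆ U≡0
        ... | T , T⊆L , |T|≡|U| , n∣T = zsf (T , ⊆-trans T⊆L (filter-⊆ _ S) , subst (0 <_) (sym |T|≡|U|) 0<|U| , T≡0)
          where
          T≡0 : IsZero ns (vsum T)
          T≡0 i = subst (lookup ns i ∣_) (trans (cong (_* sumAt i T) (d/d≡1 0<d)) (trans (*-identityˡ _) (sym (lookup-vsum T i)))) (n∣T i)
        DvK≰|L| : ¬ Dv K ≤ length L
        DvK≰|L| DvK≤|L| = no-zero-sum (proj₁ (proj₂ (isD K (Positive-υ ns d 0<d))) (map (ψ d d) L)
          (All.map⁺ (All.universal (ψ-InGroup d 0<d) L)) (subst (Dv K ≤_) (sym (length-map (ψ d d) L)) DvK≤|L|))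

      -- d' witnesses f_d(x) < 0 for x = orderCount S.
      Overfull : List (Vec ℕ r) → ℕ → ℕ → Set
      Overfull S d d' = 1 < d' × ηv (υ ns d' d) ≤ orderCount S d

      overfull-improvable : ∀ {S} → IsSeq ns S → ZeroSumFree ns S → ∀ {d d'} → 0 < d → d' ∣ d →
        Overfull S d d' → Σ (List (Vec ℕ r)) (Improvement S)
      overfull-improvable {S} seq zsf {d} {d'} 0<d d'∣d (1<d' , ηK≤|L|) =
        improve (proj₁ (proj₂ (isη K (Positive-υ ns d 0<d'))) (map (ψ d' d) L)
          (All.map⁺ (All.universal (ψ-InGroup d 0<d') L)) (subst (ηv K ≤_) (sym (length-map (ψ d' d) L)) ηK≤|L|))
        where
        0<d' = <-trans z<s 1<d'
        K = υ ns d' d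
        L = filter (λ g → ord ns g ≟ d) S
        L-ord : All (λ g → ord ns g ≡ d) L
        L-ord = All.all-filter (λ g → ord ns g ≟ d) S
        L-killed : All (λ g → Kills ns g d) L
        L-killed = All.map (λ {g} ord≡d → subst (Kills ns g) ord≡d (ord-kills ns g pos)) L-ord
        improve : HasShortZeroSumSub K (map (ψ d' d) L) → Σ (List (Vec ℕ r)) (Improvement S)
        improve (U , U⊆ , 0<|U| , |U|≤expo , U≡0) with ψ-zero-sum-lift 0<d' d'∣d L L-killed U⊆ U≡0
        ... | T , T⊆L , |T|≡|U| , n∣eT = _ , merge-improves seq zsf 0<d 1<d' d'∣d (⊆-trans T⊆L (filter-⊆ _ S))
              (All-resp-⊆ T⊆L L-ord) (subst (0 <_) (sym |T|≡|U|) 0<|U|)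
              (subst (_≤ d') (sym |T|≡|U|) (≤-trans |U|≤expo (∣⇒≤ {{>-nonZero 0<d'}} (expo-υ∣ ns d 0<d'))))
              n∣eT

      SomewhereOverfull : List (Vec ℕ r) → Set
      SomewhereOverfull S = Any (λ d → Any (Overfull S d) (divisors d)) (divisors (expo ns))

      somewhereOverfull? : ∀ S → Dec (SomewhereOverfull S)
      somewhereOverfull? S = any? (λ d → any? (λ d' → (1 <? d') ×-dec (ηv (υ ns d' d) ≤? orderCount S d)) (divisors d))
                                  (divisors (expo ns))

      somewhere-improvable : ∀ {S} → IsSeq ns S → ZeroSumFree ns S → SomewhereOverfull S →
        Σ (List (Vec ℕ r)) (Improvement S)
      somewhere-improvable {S} seq zsf overfull with find overfull
      ... | d , d∈ , overfull-at-d with find {P = Overfull S d} overfull-at-d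
      ...   | d' , d'∈ , over = overfull-improvable seq zsf (proj₁ (∈-divisors⁻ (expo ns) d∈)) (proj₂ (∈-divisors⁻ d d'∈)) over

      orderCount∈P : ∀ S → ZeroSumFree ns S → ¬ SomewhereOverfull S → InP Dv ηv ns (orderCount S)
      orderCount∈P S zsf ¬overfull d 0<d d∣n = f-bound , Davenport-bound S zsf 0<d
        where
        f-bound : fNonneg ηv ns (orderCount S) d
        f-bound d' 0<d' d'∣d d'≢1 = subst (_≤ ηv (υ ns d' d)) (+-comm 1 (orderCount S d)) (≰⇒> λ η≤ →
          ¬overfull (lose (∈-divisors⁺ 0<d (0<expo ns pos) d∣n) (lose (∈-divisors⁺ 0<d' 0<d d'∣d) (≢1⇒1< 0<d' d'≢1 , η≤))))

      ord∈divisors : ∀ g → ord ns g ∈ divisors (expo ns)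
      ord∈divisors g = ∈-divisors⁺ (1≤ord ns g) (0<expo ns pos)
        (ord∣ ns g pos (λ i → ∣m⇒∣m*n (lookup g i) (lookup∣expo ns i)))

      Bounded : List (Vec ℕ r) → Set
      Bounded S = Σ (ℕ → ℕ) λ x → InP Dv ηv ns x × kk ns S ℚ.≤ objective ns x

      orderCount-bounded : ∀ S → ZeroSumFree ns S → ¬ SomewhereOverfull S → Bounded S
      orderCount-bounded S zsf ¬overfull =
        orderCount S , orderCount∈P S zsf ¬overfull , sum-inverse≤weight (ord ns) S (All.universal ord∈divisors S)

      bounded-improvement : ∀ {S S′} → Improvement S S′ → Bounded S′ → Bounded S
      bounded-improvement improvement (x , x∈P , kS′≤) = x , x∈P , ℚ.≤-trans (Improvement.kk-≤ improvement) kS′≤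

      k-bound : ∀ S → IsSeq ns S → ZeroSumFree ns S → Bounded S
      k-bound = WF.All.wfRec (On.wellFounded length <-wellFounded) 0ℓ P step
        where
        P : List (Vec ℕ r) → Set
        P S = IsSeq ns S → ZeroSumFree ns S → Bounded S
        step : ∀ S → WfRec (_<_ on length) P S → P S
        step S rec seq zsf = by-cases (somewhereOverfull? S)
          where
          continue : Σ (List (Vec ℕ r)) (Improvement S) → Bounded S
          continue (S′ , improvement) = bounded-improvement improvement (rec {S′} shorter isSeq zeroSumFree)
            where open Improvement improvement
          by-cases : Dec (SomewhereOverfull S) → Bounded S
          by-cases (no ¬overfull) = orderCount-bounded S zsf ¬overfull
          by-cases (yes overfull) = continue (somewhere-improvable seq zsf overfull)

open import Defs
open import Data.Nat using (ℕ; z<s)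
open import Data.Nat.Properties using (<-≤-trans)
open import Data.Vec using (Vec)
open import Data.List using (List; []; _∷_)
open import Data.List.Relation.Unary.All using (_∷_)
open import Data.Product using (Σ; _×_; _,_)
open import Data.Rational using (_≤_)
open Multiplicities using (0≤weight[])
open Reduction using (zero∈P; k-bound)

corollary2p8 : (Dv ηv : ∀ {s} → Vec ℕ s → ℕ)
    → (∀ {s} (ks : Vec ℕ s) → Positive ks → IsDavenport ks (Dv ks))
    → (∀ {s} (ks : Vec ℕ s) → Positive ks → IsEta ks (ηv ks))
    → ∀ {r} (ns : Vec ℕ r) → ValidType ns
    → (S : List (Vec ℕ r)) → IsSeq ns S → ZeroSumFree ns S
    → Σ (ℕ → ℕ) λ x → InP Dv ηv ns x × kk ns S ≤ objective ns x
corollary2p8 Dv ηv isD isη ns _ [] _ _ =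
  (λ _ → 0) , zero∈P Dv ηv isD isη ns , 0≤weight[] (ord ns) (divisors (expo ns))
corollary2p8 Dv ηv isD isη ns _ S@(_ ∷ _) seq@(g∈G ∷ _) zsf =
  k-bound ns (λ i → <-≤-trans z<s (g∈G i)) Dv ηv isD isη S seq zsf
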